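{- Let $A$ and $B$ be disjoint nonempty sets of integers, of sizes $a$ and $b$ respectively. For each $u=(u_1,u_2,\ldots,u_a) \in \mathfrak{S}_A$ and $v=(v_1,v_2,\ldots,v_b) \in \mathfrak{S}_B$ there are $\frac{(a+b-1)!}{(a-1)!(b-1)!}$ cyclic shuffles in $[u] \,\sqcup\!\sqcup_{\mathrm{cyc}}\, [v]$.
   Context: For a finite set $A$ of size $a$, $\mathfrak{S}_A$ is the set of bijections $u:[a]\to A$, viewed as words $u=(u_1,\ldots,u_a)$. The cyclic class $[u]$ is the equivalence class of $u$ under cyclic rotations $(u_1,\ldots,u_a)\sim(u_{i+1},\ldots,u_a,u_1,\ldots,u_i)$. For disjoint $A,B$, a cyclic shuffle of $[u]$ and $[v]$ is a class $[w]$, $w\in\mathfrak{S}_{A\sqcup B}$, having a representative that is a shuffle (contains both as subwords) of some cyclic shift of $u$ and some cyclic shift of $v$; $[u]\,\sqcup\!\sqcup_{\mathrm{cyc}}\,[v]$ denotes the set of all such cyclic shuffles (counted as classes). -}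

module Defs where

open import Data.Nat using (ℕ; _+_; _*_; _∸_; _<_)
open import Data.Nat.Properties using (_!*_!≢0)
open import Data.Nat.DivMod using (_/_)
open import Data.Nat.Combinatorics using ()
open import Data.Nat using (_!)
open import Data.Integer using (ℤ)
open import Data.List using (List; length; drop; take; _++_)
open import Data.Product using (∃-syntax; _×_)
open import Relation.Binary.PropositionalEquality using (_≡_)
open import Data.List.Relation.Ternary.Interleaving.Propositional using (Interleaving)

rotate : ℕ → List ℤ → List ℤ
rotate i w = drop i w ++ take i w

_∼cyc_ : List ℤ → List ℤ → Set
w ∼cyc w' = ∃[ i ] (i < length w × rotate i w ≡ w')

-- [w] ∈ [u] ⧢cyc [v] : the class of w has a representative that is a
-- shuffle (interleaving) of some cyclic shift of u and some cyclic shift of v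
IsCycShuffle : List ℤ → List ℤ → List ℤ → Set
IsCycShuffle u v w =
  ∃[ i ] ∃[ j ] ∃[ w' ] (w ∼cyc w' × Interleaving (rotate i u) (rotate j v) w')

cycCount : ℕ → ℕ → ℕ
cycCount a b = _/_ ((a + b ∸ 1) !) ((a ∸ 1) ! * (b ∸ 1) !) {{(a ∸ 1) !* (b ∸ 1) !≢0}}

module Submission where

-- Write u = u₁ ∷ ut and let v have length b.
-- Every word w in which the letter u₁ occurs exactly once has exactly one
-- rotation starting with u₁; we use that rotation as the representative of
-- the cyclic class [w].  Rotating a cyclic shuffle of [u] and [v] so that
-- it starts with u₁ yields u₁ ∷ s where s interleaves ut with some rotation
-- of v; conversely every such word is a cyclic shuffle.  Hence the classes
-- are represented, without repetition, by the words u₁ ∷ s with s ranging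
-- over the shuffles of ut with each of the b rotations of v.  There are
-- (a-1+b)! / ((a-1)! b!) shuffles of two words of lengths a-1 and b, so the
-- number of classes is b · (a-1+b)! / ((a-1)! b!) = (a+b-1)! / ((a-1)! (b-1)!).

open import Defs
open import Data.Nat using (ℕ; zero; suc; _+_; _*_; _<_; _≤_; _!; z≤n; s≤s; NonZero)
open import Data.Nat.Properties
  using (+-suc; +-identityʳ; *-identityˡ; *-identityʳ; <⇒≤; <⇒≢; <-trans; ≤-trans; m≤n⇒m⊓n≡m; _!*_!≢0)
open import Data.Nat.DivMod using (_/_; m*n/n≡m)
open import Data.Nat.Solver using (module +-*-Solver)
open import Data.Integer using (ℤ)
open import Data.Fin using (Fin; zero; suc)
open import Data.Product using (∃-syntax; _×_; _,_)
open import Data.Sum using (_⊎_; inj₁; inj₂)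
open import Data.Empty using (⊥-elim)
open import Relation.Binary.PropositionalEquality
  using (_≡_; _≢_; refl; sym; trans; cong; cong₂; subst; setoid; module ≡-Reasoning)
open import Data.List using (List; []; _∷_; _++_; length; lookup; map; concat; take; drop; applyUpTo)
open import Data.List.Properties
  using (∷-injective; ∷-injectiveˡ; ∷-injectiveʳ; ++-assoc; ++-identityʳ; length-++; length-map; length-take; take++drop≡id)
open import Data.List.Membership.Propositional using (_∈_; _∉_)
open import Data.List.Membership.Propositional.Properties
  using (∈-map⁺; ∈-map⁻; ∈-++⁺ˡ; ∈-++⁺ʳ; ∈-++⁻; ∈-concat⁺′; ∈-concat⁻′; ∈-applyUpTo⁺; ∈-applyUpTo⁻; ∈-lookup)
open import Data.List.Relation.Unary.Any using (here; there; index)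
open import Data.List.Relation.Unary.Any.Properties using (lookup-index)
open import Data.List.Relation.Unary.All using ([])
import Data.List.Relation.Unary.All.Properties as All
open import Data.List.Relation.Unary.AllPairs using ([]; _∷_)
import Data.List.Relation.Unary.AllPairs.Properties as AllPairs
open import Data.List.Relation.Unary.Unique.Propositional using (Unique)
open import Data.List.Relation.Unary.Unique.Propositional.Properties
  using (map⁺; ++⁺; concat⁺; drop⁺; Unique[x∷xs]⇒x∉xs)
open import Data.List.Relation.Binary.Disjoint.Propositional using (Disjoint)
open import Data.List.Relation.Binary.Permutation.Propositional using (_↭_; ↭-sym; prep; ↭⇒↭ₛ)
open import Data.List.Relation.Binary.Permutation.Propositional.Properties using (++-comm; ++⁺ˡ; ↭-length)
import Data.List.Relation.Binary.Permutation.Setoid.Properties as PermutationSetoid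
open import Data.List.Relation.Ternary.Interleaving.Propositional
  using (Interleaving; []; consˡ; consʳ; toPermutation)

module _ {A : Set} where

  private variable
    x y : A
    l r s s′ w w′ xs ys : List A

  drop-length-++ : (xs : List A) → drop (length xs) (xs ++ ys) ≡ ys
  drop-length-++ [] = refl
  drop-length-++ (_ ∷ xs) = drop-length-++ xs

  take-length-++ : (xs : List A) → take (length xs) (xs ++ ys) ≡ xs
  take-length-++ [] = refl
  take-length-++ (x ∷ xs) = cong (x ∷_) (take-length-++ xs)

  -- Rotations as an index-free relation: w′ arises from w by moving a prefix
  -- to the end.  In this form rotations visibly compose.
  Rotation : List A → List A → Set
  Rotation w w′ = ∃[ xs ] ∃[ ys ] (w ≡ xs ++ ys × w′ ≡ ys ++ xs)

  ++-overlap : (a b c d : List A) → a ++ b ≡ c ++ d →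
    (∃[ k ] (c ≡ a ++ k × b ≡ k ++ d)) ⊎ (∃[ k ] (a ≡ c ++ k × d ≡ k ++ b))
  ++-overlap [] b c d eq = inj₁ (c , refl , eq)
  ++-overlap (x ∷ a) b [] d eq = inj₂ (x ∷ a , refl , sym eq)
  ++-overlap (x ∷ a) b (y ∷ c) d eq with ∷-injective eq
  ... | refl , eq′ with ++-overlap a b c d eq′
  ... | inj₁ (k , e₁ , e₂) = inj₁ (k , cong (x ∷_) e₁ , e₂)
  ... | inj₂ (k , e₁ , e₂) = inj₂ (k , cong (x ∷_) e₁ , e₂)

  Rotation-trans : {w₁ w₂ w₃ : List A} → Rotation w₁ w₂ → Rotation w₂ w₃ → Rotation w₁ w₃
  Rotation-trans (a , b , refl , refl) (c , d , e , refl) with ++-overlap b a c d e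
  ... | inj₁ (k , refl , refl) = k , d ++ b , ++-assoc k d b , sym (++-assoc d b k)
  ... | inj₂ (k , refl , refl) = a ++ c , k , sym (++-assoc a c k) , ++-assoc k a c

  Rotation-drop-take : (i : ℕ) (w : List A) → Rotation w (drop i w ++ take i w)
  Rotation-drop-take i w = take i w , drop i w , sym (take++drop≡id i w) , refl

  Rotation-↭ : Rotation w w′ → w′ ↭ w
  Rotation-↭ (xs , ys , refl , refl) = ++-comm ys xs

  Rotation⇒drop-take : 0 < length w → Rotation w w′ →
    ∃[ i ] (i < length w × drop i w ++ take i w ≡ w′)
  Rotation⇒drop-take 0<w (xs , [] , refl , refl) = 0 , 0<w , trans (++-identityʳ (xs ++ [])) (++-identityʳ xs)
  Rotation⇒drop-take _ (xs , y ∷ ys , refl , refl) =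
    length xs , length-prefix xs , cong₂ _++_ (drop-length-++ xs) (take-length-++ xs)
    where
    length-prefix : (xs : List A) → length xs < length (xs ++ y ∷ ys)
    length-prefix [] = s≤s z≤n
    length-prefix (_ ∷ xs) = s≤s (length-prefix xs)

  Rotation-head : Rotation (x ∷ xs) l → ∃[ l₁ ] ∃[ l₂ ] (l ≡ l₁ ++ x ∷ l₂ × l₂ ++ l₁ ≡ xs)
  Rotation-head {xs = xs} ([] , ys , refl , refl) = [] , xs , ++-identityʳ ys , ++-identityʳ xs
  Rotation-head (a ∷ xs , ys , refl , refl) = ys , xs , refl , refl

  Unique-resp-↭ : xs ↭ ys → Unique xs → Unique ys
  Unique-resp-↭ p = PermutationSetoid.Unique-resp-↭ (setoid A) (↭⇒↭ₛ p)

  Unique-++⇒Disjoint : (xs : List A) → Unique (xs ++ ys) → Disjoint xs ys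
  Unique-++⇒Disjoint (x ∷ xs) U (here refl , y∈ys) = Unique[x∷xs]⇒x∉xs U (∈-++⁺ʳ xs y∈ys)
  Unique-++⇒Disjoint (x ∷ xs) (_ ∷ U) (there y∈xs , y∈ys) = Unique-++⇒Disjoint xs U (y∈xs , y∈ys)

  -- In a word with distinct letters, the only rotation that keeps the first
  -- letter in place is the trivial one.  This makes representatives unique.
  Rotation-fixing-head : Unique (x ∷ s) → Rotation (x ∷ s) (x ∷ s′) → s ≡ s′
  Rotation-fixing-head _ ([] , ys , e₁ , e₂) = ∷-injectiveʳ (trans e₁ (sym (trans e₂ (++-identityʳ ys))))
  Rotation-fixing-head _ (xs , [] , e₁ , e₂) = ∷-injectiveʳ (trans (trans e₁ (++-identityʳ xs)) (sym e₂))
  Rotation-fixing-head U (a ∷ xs , b ∷ ys , e₁ , e₂) with ∷-injective e₁ | ∷-injective e₂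
  ... | refl , s≡ | refl , _ = ⊥-elim (Unique[x∷xs]⇒x∉xs U (subst (_ ∈_) (sym s≡) (∈-++⁺ʳ xs (here refl))))

  unique-position : (p p′ : List A) {q q′ : List A} → Unique (p ++ y ∷ q) →
    p ++ y ∷ q ≡ p′ ++ y ∷ q′ → p ≡ p′
  unique-position [] [] _ _ = refl
  unique-position [] (z ∷ p′) U eq with ∷-injective eq
  ... | refl , q≡ = ⊥-elim (Unique[x∷xs]⇒x∉xs U (subst (_ ∈_) (sym q≡) (∈-++⁺ʳ p′ (here refl))))
  unique-position (z ∷ p) [] U eq with ∷-injective eq
  ... | refl , _ = ⊥-elim (Unique[x∷xs]⇒x∉xs U (∈-++⁺ʳ p (here refl)))
  unique-position (z ∷ p) (z′ ∷ p′) (_ ∷ U) eq with ∷-injective eq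
  ... | refl , eq′ = cong (z ∷_) (unique-position p p′ U eq′)

  split-at : (k : ℕ) (w : List A) → k < length w →
    ∃[ y ] ∃[ r ] (w ≡ take k w ++ y ∷ r × drop k w ≡ y ∷ r)
  split-at zero (x ∷ w) _ = x , w , refl , refl
  split-at (suc k) (x ∷ w) (s≤s k<w) with split-at k w k<w
  ... | y , r , e , d = y , r , cong (x ∷_) e , d

  length-take-≤ : (k : ℕ) (w : List A) → k ≤ length w → length (take k w) ≡ k
  length-take-≤ k w k≤w = trans (length-take k w) (m≤n⇒m⊓n≡m k≤w)

  -- A word with distinct letters has as many distinct rotations as letters:
  -- the first letter of the rotation by i is the i-th letter.
  rotation-injective : {w : List A} {i j : ℕ} → Unique w → i < length w → j < length w →
    drop i w ++ take i w ≡ drop j w ++ take j w → i ≡ j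
  rotation-injective {w} {i} {j} U i<w j<w eq
    with split-at i w i<w | split-at j w j<w
  ... | y , r , wᵢ , dᵢ | y′ , r′ , wⱼ , dⱼ
    with ∷-injectiveˡ (trans (cong (_++ take i w) (sym dᵢ)) (trans eq (cong (_++ take j w) dⱼ)))
  ... | refl = begin
    i                  ≡⟨ length-take-≤ i w (<⇒≤ i<w) ⟨
    length (take i w)  ≡⟨ cong length same-prefix ⟩
    length (take j w)  ≡⟨ length-take-≤ j w (<⇒≤ j<w) ⟩
    j                  ∎
    where
    open ≡-Reasoning
    same-prefix : take i w ≡ take j w
    same-prefix = unique-position (take i w) (take j w) (subst Unique wᵢ U) (trans (sym wᵢ) wⱼ)

  lookup-injective : {xs : List A} → Unique xs → (i j : Fin (length xs)) →
    lookup xs i ≡ lookup xs j → i ≡ j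
  lookup-injective {_ ∷ _} _ zero zero _ = refl
  lookup-injective {_ ∷ _} U zero (suc j) e = ⊥-elim (Unique[x∷xs]⇒x∉xs U (subst (_∈ _) (sym e) (∈-lookup j)))
  lookup-injective {_ ∷ _} U (suc i) zero e = ⊥-elim (Unique[x∷xs]⇒x∉xs U (subst (_∈ _) e (∈-lookup i)))
  lookup-injective {_ ∷ _} (_ ∷ U) (suc i) (suc j) e = cong suc (lookup-injective U i j e)

  interleaving-++ : {a b c a′ b′ c′ : List A} → Interleaving a b c → Interleaving a′ b′ c′ →
    Interleaving (a ++ a′) (b ++ b′) (c ++ c′)
  interleaving-++ [] J = J
  interleaving-++ (consˡ I) J = consˡ (interleaving-++ I J)
  interleaving-++ (consʳ I) J = consʳ (interleaving-++ I J)

  interleaving-split : (l₁ : List A) {l₂ : List A} → Interleaving (l₁ ++ x ∷ l₂) r s →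
    ∃[ r₁ ] ∃[ r₂ ] ∃[ p ] ∃[ q ]
      (r ≡ r₁ ++ r₂ × s ≡ p ++ x ∷ q × Interleaving l₁ r₁ p × Interleaving l₂ r₂ q)
  interleaving-split [] (consˡ I) = [] , _ , [] , _ , refl , refl , [] , I
  interleaving-split [] (consʳ I) with interleaving-split [] I
  ... | r₁ , r₂ , p , q , refl , refl , I₁ , I₂ = _ ∷ r₁ , r₂ , _ ∷ p , q , refl , refl , consʳ I₁ , I₂
  interleaving-split (y ∷ l₁) (consˡ I) with interleaving-split l₁ I
  ... | r₁ , r₂ , p , q , refl , refl , I₁ , I₂ = r₁ , r₂ , y ∷ p , q , refl , refl , consˡ I₁ , I₂
  interleaving-split (y ∷ l₁) (consʳ I) with interleaving-split (y ∷ l₁) I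
  ... | r₁ , r₂ , p , q , refl , refl , I₁ , I₂ = _ ∷ r₁ , r₂ , _ ∷ p , q , refl , refl , consʳ I₁ , I₂

  interleaving-determined : {r′ : List A} → Disjoint l r → Disjoint l r′ →
    Interleaving l r s → Interleaving l r′ s → r ≡ r′
  interleaving-determined _ _ [] [] = refl
  interleaving-determined d d′ (consˡ I) (consˡ J) =
    interleaving-determined (λ (a , b) → d (there a , b)) (λ (a , b) → d′ (there a , b)) I J
  interleaving-determined d d′ (consʳ I) (consʳ J) =
    cong (_ ∷_) (interleaving-determined (λ (a , b) → d (a , there b)) (λ (a , b) → d′ (a , there b)) I J)
  interleaving-determined _ d′ (consˡ I) (consʳ J) = ⊥-elim (d′ (here refl , here refl))
  interleaving-determined d _ (consʳ I) (consˡ J) = ⊥-elim (d (here refl , here refl))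

  interleaving-of-rotation : Rotation (x ∷ xs) l → Interleaving l r w →
    ∃[ s ] ∃[ r′ ] (Rotation w (x ∷ s) × Rotation r r′ × Interleaving xs r′ s)
  interleaving-of-rotation {x} rot I with Rotation-head rot
  ... | l₁ , l₂ , refl , refl with interleaving-split l₁ I
  ... | r₁ , r₂ , p , q , refl , refl , I₁ , I₂ =
    q ++ p , r₂ ++ r₁ , (p , x ∷ q , refl , refl) , (r₁ , r₂ , refl , refl) , interleaving-++ I₂ I₁

  shuffles : List A → List A → List (List A)
  shuffles [] ys = ys ∷ []
  shuffles (x ∷ xs) [] = (x ∷ xs) ∷ []
  shuffles (x ∷ xs) (y ∷ ys) = map (x ∷_) (shuffles xs (y ∷ ys)) ++ map (y ∷_) (shuffles (x ∷ xs) ys)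

  shuffles-sound : (xs ys : List A) → s ∈ shuffles xs ys → Interleaving xs ys s
  shuffles-sound [] ys (here refl) = only-right ys
    where
    only-right : (ys : List A) → Interleaving [] ys ys
    only-right [] = []
    only-right (y ∷ ys) = consʳ (only-right ys)
  shuffles-sound (x ∷ xs) [] (here refl) = only-left (x ∷ xs)
    where
    only-left : (xs : List A) → Interleaving xs [] xs
    only-left [] = []
    only-left (x ∷ xs) = consˡ (only-left xs)
  shuffles-sound (x ∷ xs) (y ∷ ys) s∈ with ∈-++⁻ (map (x ∷_) (shuffles xs (y ∷ ys))) s∈
  ... | inj₁ s∈ˡ with ∈-map⁻ (x ∷_) s∈ˡ
  ...   | s′ , s′∈ , refl = consˡ (shuffles-sound xs (y ∷ ys) s′∈)
  shuffles-sound (x ∷ xs) (y ∷ ys) _ | inj₂ s∈ʳ with ∈-map⁻ (y ∷_) s∈ʳ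
  ...   | s′ , s′∈ , refl = consʳ (shuffles-sound (x ∷ xs) ys s′∈)

  shuffles-complete : {xs ys s : List A} → Interleaving xs ys s → s ∈ shuffles xs ys
  shuffles-complete {[]} I = here (only-right I)
    where
    only-right : {ys s : List A} → Interleaving [] ys s → s ≡ ys
    only-right [] = refl
    only-right (consʳ I) = cong (_ ∷_) (only-right I)
  shuffles-complete {x ∷ xs} {[]} I = here (only-left I)
    where
    only-left : {xs s : List A} → Interleaving xs [] s → s ≡ xs
    only-left [] = refl
    only-left (consˡ I) = cong (_ ∷_) (only-left I)
  shuffles-complete {x ∷ xs} {y ∷ ys} (consˡ I) = ∈-++⁺ˡ (∈-map⁺ (x ∷_) (shuffles-complete I))
  shuffles-complete {x ∷ xs} {y ∷ ys} (consʳ I) = ∈-++⁺ʳ _ (∈-map⁺ (y ∷_) (shuffles-complete I))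

  -- For words without common letters the enumeration has no repetitions:
  -- shuffles starting with x and with y differ in their first letter.
  shuffles-unique : (xs ys : List A) → Disjoint xs ys → Unique (shuffles xs ys)
  shuffles-unique [] ys _ = [] ∷ []
  shuffles-unique (x ∷ xs) [] _ = [] ∷ []
  shuffles-unique (x ∷ xs) (y ∷ ys) d =
    ++⁺ (map⁺ ∷-injectiveʳ (shuffles-unique xs (y ∷ ys) (λ (a , b) → d (there a , b))))
        (map⁺ ∷-injectiveʳ (shuffles-unique (x ∷ xs) ys (λ (a , b) → d (a , there b))))
        different-heads
    where
    different-heads : Disjoint (map (x ∷_) (shuffles xs (y ∷ ys))) (map (y ∷_) (shuffles (x ∷ xs) ys))
    different-heads (w∈ˡ , w∈ʳ) with ∈-map⁻ (x ∷_) w∈ˡ | ∈-map⁻ (y ∷_) w∈ʳ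
    ... | _ , _ , refl | _ , _ , e = d (here refl , here (∷-injectiveˡ e))

shuffleCount : ℕ → ℕ → ℕ
shuffleCount zero n = 1
shuffleCount (suc m) zero = 1
shuffleCount (suc m) (suc n) = shuffleCount m (suc n) + shuffleCount (suc m) n

length-shuffles : {A : Set} (xs ys : List A) → length (shuffles xs ys) ≡ shuffleCount (length xs) (length ys)
length-shuffles [] ys = refl
length-shuffles (x ∷ xs) [] = refl
length-shuffles (x ∷ xs) (y ∷ ys) = begin
  length (map (x ∷_) S₁ ++ map (y ∷_) S₂)        ≡⟨ length-++ (map (x ∷_) S₁) ⟩
  length (map (x ∷_) S₁) + length (map (y ∷_) S₂) ≡⟨ cong₂ _+_ (length-map (x ∷_) S₁) (length-map (y ∷_) S₂) ⟩
  length S₁ + length S₂                           ≡⟨ cong₂ _+_ (length-shuffles xs (y ∷ ys)) (length-shuffles (x ∷ xs) ys) ⟩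
  shuffleCount (length (x ∷ xs)) (length (y ∷ ys)) ∎
  where
  open ≡-Reasoning
  S₁ = shuffles xs (y ∷ ys)
  S₂ = shuffles (x ∷ xs) ys

shuffleCount-factorial : (m n : ℕ) → shuffleCount m n * (m ! * n !) ≡ (m + n) !
shuffleCount-factorial zero n = trans (*-identityˡ _) (*-identityˡ _)
shuffleCount-factorial (suc m) zero =
  trans (*-identityˡ _) (trans (*-identityʳ _) (cong _! (sym (+-identityʳ (suc m)))))
shuffleCount-factorial (suc m) (suc n) = begin
  (A + B) * (suc m ! * suc n !)                         ≡⟨ pascal-regroup A B m n (m !) (n !) ⟩
  A * (m ! * suc n !) * suc m + B * (suc m ! * n !) * suc n
    ≡⟨ cong₂ (λ p q → p * suc m + q * suc n) (trans (shuffleCount-factorial m (suc n)) (cong _! (+-suc m n)))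
                                              (shuffleCount-factorial (suc m) n) ⟩
  F * suc m + F * suc n                                ≡⟨ factor-out F m n ⟩
  suc (suc (m + n)) * F                                ≡⟨ cong (λ k → suc k !) (sym (+-suc m n)) ⟩
  (suc m + suc n) !                                    ∎
  where
  open ≡-Reasoning
  open +-*-Solver
  A = shuffleCount m (suc n)
  B = shuffleCount (suc m) n
  F = suc (m + n) !
  pascal-regroup : ∀ A B m n a b →
    (A + B) * ((suc m * a) * (suc n * b)) ≡ A * (a * (suc n * b)) * suc m + B * ((suc m * a) * b) * suc n
  pascal-regroup = solve 6 (λ A B m n a b →
    (A :+ B) :* (((con 1 :+ m) :* a) :* ((con 1 :+ n) :* b)) :=
    A :* (a :* ((con 1 :+ n) :* b)) :* (con 1 :+ m) :+ B :* (((con 1 :+ m) :* a) :* b) :* (con 1 :+ n)) refl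
  factor-out : ∀ F m n → F * suc m + F * suc n ≡ suc (suc (m + n)) * F
  factor-out = solve 3 (λ F m n → F :* (con 1 :+ m) :+ F :* (con 1 :+ n) := (con 2 :+ (m :+ n)) :* F) refl

cycCount-shuffleCount : (a b : ℕ) → suc b * shuffleCount a (suc b) ≡ cycCount (suc a) (suc b)
cycCount-shuffleCount a b = begin
  suc b * S                  ≡⟨ m*n/n≡m (suc b * S) D ⟨
  suc b * S * D / D          ≡⟨ cong (_/ D) (regroup (suc b) S (a !) (b !)) ⟩
  S * (a ! * suc b !) / D    ≡⟨ cong (_/ D) (shuffleCount-factorial a (suc b)) ⟩
  (a + suc b) ! / D          ∎
  where
  open ≡-Reasoning
  open +-*-Solver
  S = shuffleCount a (suc b)
  D = a ! * b !
  instance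
    D≢0 : NonZero D
    D≢0 = a !* b !≢0
  regroup : ∀ c S x y → c * S * (x * y) ≡ S * (x * (c * y))
  regroup = solve 4 (λ c S x y → c :* S :* (x :* y) := S :* (x :* (c :* y))) refl

length-concat-applyUpTo : {B : Set} (f : ℕ → List B) (n c : ℕ) → (∀ i → length (f i) ≡ c) →
  length (concat (applyUpTo f n)) ≡ n * c
length-concat-applyUpTo f zero c _ = refl
length-concat-applyUpTo f (suc n) c len = trans (length-++ (f 0))
  (cong₂ _+_ (len 0) (length-concat-applyUpTo (λ i → f (suc i)) n c (λ i → len (suc i))))

∼cyc⇒Rotation : {w w′ : List ℤ} → w ∼cyc w′ → Rotation w w′
∼cyc⇒Rotation {w} (i , _ , e) = subst (Rotation w) e (Rotation-drop-take i w)

module Representatives (u₁ : ℤ) (ut : List ℤ) (v₁ : ℤ) (vt : List ℤ)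
                       (distinct : Unique (u₁ ∷ ut ++ v₁ ∷ vt)) where

  u v : List ℤ
  u = u₁ ∷ ut
  v = v₁ ∷ vt

  block : ℕ → List (List ℤ)
  block i = map (u₁ ∷_) (shuffles ut (rotate i v))

  representatives : List (List ℤ)
  representatives = concat (applyUpTo block (length v))

  rotation-↭ : (i : ℕ) → rotate i v ↭ v
  rotation-↭ i = Rotation-↭ (Rotation-drop-take i v)

  distinct-rotation : (i : ℕ) → Unique (u₁ ∷ ut ++ rotate i v)
  distinct-rotation i = Unique-resp-↭ (↭-sym (prep u₁ (++⁺ˡ ut (rotation-↭ i)))) distinct

  distinct-v : Unique v
  distinct-v = subst Unique (drop-length-++ u) (drop⁺ (length u) distinct)

  ut-disjoint : (i : ℕ) → Disjoint ut (rotate i v)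
  ut-disjoint i with distinct-rotation i
  ... | _ ∷ U = Unique-++⇒Disjoint ut U

  -- representatives have distinct letters, so rotations cannot identify two of them
  representative-distinct : {i : ℕ} {s : List ℤ} → Interleaving ut (rotate i v) s → Unique (u₁ ∷ s)
  representative-distinct {i} I =
    Unique-resp-↭ (↭-sym (prep u₁ (toPermutation I))) (distinct-rotation i)

  representatives-sound : {w : List ℤ} → w ∈ representatives →
    ∃[ i ] ∃[ s ] (i < length v × w ≡ u₁ ∷ s × Interleaving ut (rotate i v) s)
  representatives-sound w∈ with ∈-concat⁻′ (applyUpTo block (length v)) w∈
  ... | ws , w∈ws , ws∈ with ∈-applyUpTo⁻ block ws∈
  ... | i , i<v , refl with ∈-map⁻ (u₁ ∷_) w∈ws
  ... | s , s∈ , refl = i , s , i<v , refl , shuffles-sound ut (rotate i v) s∈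

  representatives-complete : {i : ℕ} {s : List ℤ} → i < length v → Interleaving ut (rotate i v) s →
    u₁ ∷ s ∈ representatives
  representatives-complete i<v I =
    ∈-concat⁺′ (∈-map⁺ (u₁ ∷_) (shuffles-complete I)) (∈-applyUpTo⁺ block i<v)

  -- different rotations of v give disjoint blocks, since the interleaving
  -- determines the rotation and the rotations of v are pairwise distinct
  blocks-disjoint : {i j : ℕ} → i < j → j < length v → Disjoint (block i) (block j)
  blocks-disjoint {i} {j} i<j j<v (w∈ᵢ , w∈ⱼ) with ∈-map⁻ (u₁ ∷_) w∈ᵢ | ∈-map⁻ (u₁ ∷_) w∈ⱼ
  ... | s , s∈ , refl | s′ , s′∈ , e =
    <⇒≢ i<j (rotation-injective distinct-v (<-trans i<j j<v) j<v
      (interleaving-determined (ut-disjoint i) (ut-disjoint j)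
        (shuffles-sound ut (rotate i v) s∈)
        (subst (Interleaving ut (rotate j v)) (sym (∷-injectiveʳ e))
          (shuffles-sound ut (rotate j v) s′∈))))

  representatives-unique : Unique representatives
  representatives-unique = concat⁺
    (All.applyUpTo⁺₂ block (length v)
      (λ i → map⁺ ∷-injectiveʳ (shuffles-unique ut (rotate i v) (ut-disjoint i))))
    (AllPairs.applyUpTo⁺₁ block (length v) blocks-disjoint)

  representatives-length : length representatives ≡ length v * shuffleCount (length ut) (length v)
  representatives-length = length-concat-applyUpTo block (length v) _ λ i → begin
    length (block i)                                ≡⟨ length-map (u₁ ∷_) (shuffles ut (rotate i v)) ⟩
    length (shuffles ut (rotate i v))               ≡⟨ length-shuffles ut (rotate i v) ⟩
    shuffleCount (length ut) (length (rotate i v))  ≡⟨ cong (shuffleCount (length ut)) (↭-length (rotation-↭ i)) ⟩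
    shuffleCount (length ut) (length v)             ∎
    where open ≡-Reasoning

  representatives-cycShuffle : {w : List ℤ} → w ∈ representatives → IsCycShuffle u v w
  representatives-cycShuffle w∈ with representatives-sound w∈
  ... | i , s , _ , refl , I =
    0 , i , u₁ ∷ s , (0 , s≤s z≤n , ++-identityʳ (u₁ ∷ s)) ,
    subst (λ l → Interleaving l (rotate i v) (u₁ ∷ s)) (sym (++-identityʳ u)) (consˡ I)

  -- two cyclically equivalent representatives both start with u₁, hence coincide
  representatives-inequivalent : {w w′ : List ℤ} → w ∈ representatives → w′ ∈ representatives →
    w ∼cyc w′ → w ≡ w′
  representatives-inequivalent w∈ w′∈ w∼w′ with representatives-sound w∈ | representatives-sound w′∈
  ... | i , _ , _ , refl , I | _ , _ , _ , refl , _ =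
    cong (u₁ ∷_) (Rotation-fixing-head (representative-distinct {i} I) (∼cyc⇒Rotation w∼w′))

  representatives-cover : {w : List ℤ} → IsCycShuffle u v w →
    ∃[ w′ ] (w′ ∈ representatives × w ∼cyc w′)
  representatives-cover (i , j , w′ , w∼w′@(k , k<w , _) , I)
    with interleaving-of-rotation (Rotation-drop-take i u) I
  ... | s , r , w′↻ , r↻ , I′ with Rotation⇒drop-take (s≤s z≤n) (Rotation-trans (Rotation-drop-take j v) r↻)
  ... | m , m<v , refl =
    u₁ ∷ s , representatives-complete m<v I′ ,
    Rotation⇒drop-take (≤-trans (s≤s z≤n) k<w) (Rotation-trans (∼cyc⇒Rotation w∼w′) w′↻)

proposition3p23 : (u v : List ℤ) → u ≢ [] → v ≢ [] → Unique u → Unique v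
    → (∀ x → x ∈ u → x ∉ v)
    → ∃[ reps ] (length reps ≡ cycCount (length u) (length v)
        × (∀ i → IsCycShuffle u v (lookup reps i))
        × (∀ i j → lookup reps i ∼cyc lookup reps j → i ≡ j)
        × (∀ w → IsCycShuffle u v w → ∃[ i ] (w ∼cyc lookup reps i)))
proposition3p23 [] _ u≢[] _ _ _ _ = ⊥-elim (u≢[] refl)
proposition3p23 _ [] _ v≢[] _ _ _ = ⊥-elim (v≢[] refl)
proposition3p23 (u₁ ∷ ut) (v₁ ∷ vt) _ _ Uu Uv u#v =
  representatives , count , (λ i → representatives-cycShuffle (∈-lookup i)) , inequivalent , cover
  where
  open Representatives u₁ ut v₁ vt (++⁺ Uu Uv (λ (x∈u , x∈v) → u#v _ x∈u x∈v))
  count : length representatives ≡ cycCount (length u) (length v)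
  count = trans representatives-length (cycCount-shuffleCount (length ut) (length vt))
  inequivalent : ∀ i j → lookup representatives i ∼cyc lookup representatives j → i ≡ j
  inequivalent i j c = lookup-injective representatives-unique i j
    (representatives-inequivalent (∈-lookup i) (∈-lookup j) c)
  cover : ∀ w → IsCycShuffle u v w → ∃[ i ] (w ∼cyc lookup representatives i)
  cover w c with representatives-cover c
  ... | w′ , w′∈ , w∼w′ = index w′∈ , subst (w ∼cyc_) (lookup-index w′∈) w∼w′
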